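{- Let $\mathcal{Q}:\varphi$ be an SSAT formula with $\mathcal{Q} = Q_1x_1\ldots Q_nx_n$ and $\varphi$ in conjunctive normal form containing only non-tautological clauses. Let $c^p$ be an annotated clause derivable from $\mathcal{Q}:\varphi$ by S-resolution, and let $\mathcal{Q}(c) = Q_1x_1\ldots Q_ix_i$. Then for each assignment $\tau : \{x_1,\dots,x_i\}\to\{\mathrm{true},\mathrm{false}\}$ with $\tau(x) = \mathrm{ff}_c(x)$ for all $x\in\mathrm{Var}(c)$, it holds that $Pr(Q_{i+1}x_{i+1}\ldots Q_nx_n : \varphi[\tau(x_1)/x_1]\ldots[\tau(x_i)/x_i]) = p.$
   Context: An SSAT formula is $\mathcal{Q} : \varphi$ where $\mathcal{Q} = Q_1x_1\ldots Q_nx_n$ is a prefix of quantified propositional variables, each $Q_i$ being either $\exists$ or a randomized quantifier $\mathsf{R}^{p_i}$ with rational $0<p_i<1$, and $\varphi$ is a propositional formula with $\mathrm{Var}(\varphi)\subseteq\{x_1,\dots,x_n\}$. Its maximum probability of satisfaction is defined recursively: $Pr(\varepsilon:\varphi)$ is $0$ if $\varphi$ is equivalent to false and $1$ if equivalent to true; $Pr(\exists x\,\mathcal{Q}':\varphi) = \max(Pr(\mathcal{Q}':\varphi[\mathrm{true}/x]),Pr(\mathcal{Q}':\varphi[\mathrm{false}/x]))$; $Pr(\mathsf{R}^p x\,\mathcal{Q}':\varphi) = p\,Pr(\mathcal{Q}':\varphi[\mathrm{true}/x]) + (1-p)\,Pr(\mathcal{Q}':\varphi[\mathrm{false}/x])$.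 A clause is a disjunction (identified with a set) of literals without repetitions; it is tautological if it is valid. For a propositional formula $\psi$ with $\mathrm{Var}(\psi)\subseteq\{x_1,\dots,x_n\}$, $\mathcal{Q}(\psi)$ is the shortest prefix $Q_1x_1\ldots Q_ix_i$ of $\mathcal{Q}$ containing all variables of $\psi$ (so $i=0$ if $\psi$ has no variables). For a non-tautological clause $c$, $\mathrm{ff}_c : \mathrm{Var}(c)\to\{\mathrm{true},\mathrm{false}\}$ is the unique assignment falsifying $c$: $\mathrm{ff}_c(x)=\mathrm{true}$ if $\neg x\in c$ and $\mathrm{false}$ if $x \in c$. S-resolution derives annotated clauses $c^p$ ($0\le p\le1$) by the rules: (R.1) for every clause $c$ of $\varphi$, derive $c^0$. (R.2) if $c$ is a non-tautological clause over literals of variables in $\mathrm{Var}(\varphi)$, $\mathcal{Q}(c) = Q_1x_1\ldots Q_ix_i$, and for every $\tau:\{x_1,\dots,x_i\}\to\{\mathrm{true},\mathrm{false}\}$ with $\tau(x)=\mathrm{ff}_c(x)$ for all $x\in\mathrm{Var}(c)$ the formula $\varphi[\tau(x_1)/x_1]\ldots[\tau(x_i)/x_i]$ is valid, derive $c^1$. (R.3) from derived $(c_1\vee\neg x)^{p_1}$ and $(c_2\vee x)^{p_2}$, where $Qx$ occurs in $\mathcal{Q}$ but not in $\mathcal{Q}(c_1\vee c_2)$ and $c_1\vee c_2$ is non-tautological, derive $(c_1\vee c_2)^p$ with $p=\max(p_1,p_2)$ if $Q=\exists$ and $p = p_x p_1 + (1-p_x)p_2$ if $Q = \mathsf{R}^{p_x}$.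 -}

module Defs where

open import Data.Nat using (ℕ; zero; suc; _<_; _≤_) renaming (_⊔_ to _⊔ℕ_)
open import Data.Fin using (Fin; toℕ; _≟_)
open import Data.Bool using (Bool; true; false; not; if_then_else_)
open import Data.List using (List; []; _∷_; foldr; allFin; drop)
open import Data.Bool.ListAction using (any; all)
open import Data.List.Membership.Propositional using (_∈_; _∉_)
open import Data.List.Relation.Unary.All using (All)
open import Data.List.Relation.Unary.Unique.Propositional using (Unique)
open import Data.Rational using (ℚ; 0ℚ; 1ℚ; _+_; _*_; _-_; _⊔_) renaming (_<_ to _<ℚ_)
open import Data.Product using (Σ; _×_; ∃; ∃-syntax)
open import Data.Sum using (_⊎_)
open import Relation.Nullary using (¬_; does)
open import Relation.Binary.PropositionalEquality using (_≡_; _≢_)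

data Quant : Set where
  ∃Q : Quant
  RQ : (p : ℚ) → 0ℚ <ℚ p → p <ℚ 1ℚ → Quant

-- A prefix Q₁x₁ … Qₙxₙ: variable xᵢ is (Fin n) index i-1, quantified by Q at that index.
Prefix : ℕ → Set
Prefix n = Fin n → Quant

data Lit (n : ℕ) : Set where
  pos : Fin n → Lit n
  neg : Fin n → Lit n

var : ∀ {n} → Lit n → Fin n
var (pos x) = x
var (neg x) = x

-- A clause is a list of literals; "without repetitions" is imposed via Unique where needed.
Clause : ℕ → Set
Clause n = List (Lit n)

CNF : ℕ → Set
CNF n = List (Clause n)

Assignment : ℕ → Set
Assignment n = Fin n → Bool

evalLit : ∀ {n} → Assignment n → Lit n → Bool
evalLit σ (pos x) = σ x
evalLit σ (neg x) = not (σ x)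

evalClause : ∀ {n} → Assignment n → Clause n → Bool
evalClause σ c = any (evalLit σ) c

evalCNF : ∀ {n} → Assignment n → CNF n → Bool
evalCNF σ φ = all (evalClause σ) φ

NonTaut : ∀ {n} → Clause n → Set
NonTaut c = ∀ x → ¬ (pos x ∈ c × neg x ∈ c)

ProperClause : ∀ {n} → Clause n → Set
ProperClause c = Unique c × NonTaut c

-- The number i such that 𝒬(c) = Q₁x₁ … Qᵢxᵢ (shortest prefix containing Var(c)).
qlen : ∀ {n} → Clause n → ℕ
qlen c = foldr (λ l m → suc (toℕ (var l)) ⊔ℕ m) 0 c

AgreesFF : ∀ {n} → Clause n → Assignment n → Set
AgreesFF c τ = ∀ x → (pos x ∈ c → τ x ≡ false) × (neg x ∈ c → τ x ≡ true)

AgreeBelow : ∀ {n} → ℕ → Assignment n → Assignment n → Set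
AgreeBelow i σ τ = ∀ x → toℕ x < i → σ x ≡ τ x

VarsIn : ∀ {n} → Clause n → CNF n → Set
VarsIn c φ = ∀ l → l ∈ c → ∃[ d ] (d ∈ φ × (pos (var l) ∈ d ⊎ neg (var l) ∈ d))

update : ∀ {n} → Assignment n → Fin n → Bool → Assignment n
update σ x b y = if does (y ≟ x) then b else σ y

-- Pr(Q_{j₁}x_{j₁} … Q_{jₖ}x_{jₖ} : φ[σ]) for the listed (remaining) variables;
-- the values of σ on the listed variables are overwritten by the quantifiers,
-- and once all are processed every variable of φ is assigned, so φ is
-- equivalent to true/false according to its evaluation.
pr : ∀ {n} → Prefix n → CNF n → List (Fin n) → Assignment n → ℚ
pr Q φ [] σ = if evalCNF σ φ then 1ℚ else 0ℚ
pr Q φ (x ∷ xs) σ with Q x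
... | ∃Q = pr Q φ xs (update σ x true) ⊔ pr Q φ xs (update σ x false)
... | RQ p _ _ = p * pr Q φ xs (update σ x true) + (1ℚ - p) * pr Q φ xs (update σ x false)

suffixVars : ∀ n → ℕ → List (Fin n)
suffixVars n i = drop i (allFin n)

data Derives {n} (Q : Prefix n) (φ : CNF n) : Clause n → ℚ → Set where
  R1 : ∀ {c} → c ∈ φ → Derives Q φ c 0ℚ
  R2 : ∀ {c} → ProperClause c → VarsIn c φ →
       (∀ τ → AgreesFF c τ → ∀ σ → AgreeBelow (qlen c) σ τ → evalCNF σ φ ≡ true) →
       Derives Q φ c 1ℚ
  -- from (c₁ ∨ ¬x)^{p₁} (= d₁) and (c₂ ∨ x)^{p₂} (= d₂), derive (c₁ ∨ c₂)^p,
  -- where c₁ ∨ c₂ is represented by any repetition-free list c with the right members.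
  R3∃ : ∀ {d₁ d₂ c p₁ p₂} (x : Fin n) →
       Derives Q φ d₁ p₁ → Derives Q φ d₂ p₂ → neg x ∈ d₁ → pos x ∈ d₂ →
       (∀ l → l ∈ c → (l ∈ d₁ × l ≢ neg x) ⊎ (l ∈ d₂ × l ≢ pos x)) →
       (∀ l → (l ∈ d₁ × l ≢ neg x) ⊎ (l ∈ d₂ × l ≢ pos x) → l ∈ c) →
       ProperClause c → qlen c ≤ toℕ x → Q x ≡ ∃Q →
       Derives Q φ c (p₁ ⊔ p₂)
  R3R : ∀ {d₁ d₂ c p₁ p₂} (x : Fin n) (px : ℚ) (h₀ : 0ℚ <ℚ px) (h₁ : px <ℚ 1ℚ) →
       Derives Q φ d₁ p₁ → Derives Q φ d₂ p₂ → neg x ∈ d₁ → pos x ∈ d₂ →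
       (∀ l → l ∈ c → (l ∈ d₁ × l ≢ neg x) ⊎ (l ∈ d₂ × l ≢ pos x)) →
       (∀ l → (l ∈ d₁ × l ≢ neg x) ⊎ (l ∈ d₂ × l ≢ pos x) → l ∈ c) →
       ProperClause c → qlen c ≤ toℕ x → Q x ≡ RQ px h₀ h₁ →
       Derives Q φ c (px * p₁ + (1ℚ - px) * p₂)

module Submission where

-- Updating a variable beyond 𝒬(c) keeps an assignment
-- falsifying c (for R2: agreeing with τ on 𝒬(c)), and quantifying a variable out of a
-- value that is the same on all such assignments gives that value back, both for max
-- and for p·v + (1−p)·v. So it suffices to compute pr on these assignments at a single
-- suffix: for R1 and R2 the empty one, where φ is false resp. true; for a resolvent
-- the suffix starting at the pivot x, where the quantifier of x combines the values of
-- the two premises, which are falsified by setting x true resp. false.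

open import Defs
open import Data.Nat using (ℕ; zero; suc; _≤_; _<_; _∸_; z≤n; s≤s) renaming (_+_ to _+ℕ_)
open import Data.Nat.Properties
  using (≤-refl; ≤-reflexive; ≤-trans; ≤-antisym; <⇒≱; m≤n⇒m≤1+n; m≤m⊔n; m≤n⊔m; ⊔-lub; m+[n∸m]≡n)
open import Data.Fin using (Fin; toℕ) renaming (_≟_ to _≟ᶠ_)
open import Data.Fin.Properties using (toℕ<n)
open import Data.Rational using (ℚ; 0ℚ; 1ℚ; _+_; _*_; _-_; -_; _⊔_)
open import Data.Rational.Properties
  using (+-comm; +-assoc; +-inverseˡ; +-identityʳ; *-distribʳ-+; *-identityˡ; ⊔-idem)
open import Data.Bool using (true; false; not; if_then_else_)
open import Data.Bool.Properties using (∧-zeroʳ; not-injective)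
open import Data.List using (List; []; _∷_; _++_; drop; take; tabulate; allFin)
open import Data.List.Properties using (take++drop≡id; drop-drop; drop-all; length-tabulate)
open import Data.List.Membership.Propositional using (_∈_)
open import Data.List.Relation.Unary.Any using (here; there)
open import Data.List.Relation.Unary.All as All using (All; []; _∷_)
open import Data.List.Relation.Unary.All.Properties using (take⁺; tabulate⁺)
open import Data.Product using (_×_; _,_; proj₁; proj₂)
open import Data.Sum using (_⊎_; inj₁; inj₂)
open import Data.Empty using (⊥-elim)
open import Relation.Nullary using (yes; no)
open import Relation.Nullary.Decidable using (map′)
open import Relation.Binary.Definitions using (DecidableEquality)
open import Relation.Binary.PropositionalEquality

p*v+[1-p]*v≡v : ∀ p v → p * v + (1ℚ - p) * v ≡ v
p*v+[1-p]*v≡v p v = begin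
  p * v + (1ℚ - p) * v   ≡⟨ *-distribʳ-+ v p (1ℚ - p) ⟨
  (p + (1ℚ + - p)) * v   ≡⟨ cong (_* v) (+-comm p (1ℚ + - p)) ⟩
  ((1ℚ + - p) + p) * v   ≡⟨ cong (_* v) (+-assoc 1ℚ (- p) p) ⟩
  (1ℚ + (- p + p)) * v   ≡⟨ cong (λ q → (1ℚ + q) * v) (+-inverseˡ p) ⟩
  (1ℚ + 0ℚ) * v          ≡⟨ cong (_* v) (+-identityʳ 1ℚ) ⟩
  1ℚ * v                 ≡⟨ *-identityˡ v ⟩
  v                      ∎
  where open ≡-Reasoning

drop-tabulate : ∀ {m} {A : Set} (f : Fin m → A) (i : Fin m) →
                drop (toℕ i) (tabulate f) ≡ f i ∷ drop (suc (toℕ i)) (tabulate f)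
drop-tabulate f Fin.zero    = refl
drop-tabulate f (Fin.suc i) = drop-tabulate (λ k → f (Fin.suc k)) i

drop-tabulate⁺ : ∀ {m} {A : Set} {P : A → Set} i {f : Fin m → A} →
                 (∀ k → i ≤ toℕ k → P (f k)) → All P (drop i (tabulate f))
drop-tabulate⁺ zero    h = tabulate⁺ (λ k → h k z≤n)
drop-tabulate⁺ {zero}  (suc i) h = []
drop-tabulate⁺ {suc m} (suc i) h = drop-tabulate⁺ i (λ k i≤k → h (Fin.suc k) (s≤s i≤k))

module _ {n : ℕ} where

  suffixVars-∷ : (x : Fin n) → suffixVars n (toℕ x) ≡ x ∷ suffixVars n (suc (toℕ x))
  suffixVars-∷ = drop-tabulate (λ x → x)

  suffixVars-all : suffixVars n n ≡ []
  suffixVars-all = drop-all n (allFin n) (≤-reflexive (length-tabulate (λ x → x)))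

  suffixVars-≥ : ∀ i → All (λ y → i ≤ toℕ y) (suffixVars n i)
  suffixVars-≥ i = drop-tabulate⁺ i (λ _ i≤k → i≤k)

  suffixVars-++ : ∀ {i j} → i ≤ j → suffixVars n i ≡ take (j ∸ i) (suffixVars n i) ++ suffixVars n j
  suffixVars-++ {i} {j} i≤j = begin
    suffixVars n i                             ≡⟨ take++drop≡id (j ∸ i) (suffixVars n i) ⟨
    segment ++ drop (j ∸ i) (suffixVars n i)   ≡⟨ cong (segment ++_) (drop-drop i (j ∸ i) (allFin n)) ⟩
    segment ++ drop (i +ℕ (j ∸ i)) (allFin n)  ≡⟨ cong (λ k → segment ++ drop k (allFin n)) (m+[n∸m]≡n i≤j) ⟩
    segment ++ suffixVars n j                  ∎
    where
    open ≡-Reasoning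
    segment : List (Fin n)
    segment = take (j ∸ i) (suffixVars n i)

  _≟ᴸ_ : DecidableEquality (Lit n)
  pos x ≟ᴸ pos y = map′ (cong pos) (λ { refl → refl }) (x ≟ᶠ y)
  neg x ≟ᴸ neg y = map′ (cong neg) (λ { refl → refl }) (x ≟ᶠ y)
  pos x ≟ᴸ neg y = no (λ ())
  neg x ≟ᴸ pos y = no (λ ())

  var<qlen : ∀ {l} (c : Clause n) → l ∈ c → toℕ (var l) < qlen c
  var<qlen (l ∷ c) (here refl) = m≤m⊔n _ (qlen c)
  var<qlen (l ∷ c) (there l∈c) = ≤-trans (var<qlen c l∈c) (m≤n⊔m (suc (toℕ (var l))) (qlen c))

  qlen-least : ∀ {m} (c : Clause n) → (∀ {l} → l ∈ c → toℕ (var l) < m) → qlen c ≤ m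
  qlen-least []      h = z≤n
  qlen-least (l ∷ c) h = ⊔-lub (h (here refl)) (qlen-least c (λ l∈c → h (there l∈c)))

  qlen≤n : (c : Clause n) → qlen c ≤ n
  qlen≤n c = qlen-least c (λ {l} _ → toℕ<n (var l))

  var≢ : ∀ {l y} (c : Clause n) → l ∈ c → qlen c ≤ toℕ y → var l ≢ y
  var≢ c l∈c c≤y refl = <⇒≱ (var<qlen c l∈c) c≤y

  update-same : ∀ (σ : Assignment n) x b → update σ x b x ≡ b
  update-same σ x b with x ≟ᶠ x
  ... | yes _  = refl
  ... | no x≢x = ⊥-elim (x≢x refl)

  update-other : ∀ (σ : Assignment n) {x} b {y} → y ≢ x → update σ x b y ≡ σ y
  update-other σ {x} b {y} y≢x with y ≟ᶠ x
  ... | yes y≡x = ⊥-elim (y≢x y≡x)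
  ... | no _    = refl

  evalLit-update-other : ∀ (σ : Assignment n) {x} b l → var l ≢ x → evalLit (update σ x b) l ≡ evalLit σ l
  evalLit-update-other σ b (pos y) y≢x = update-other σ b y≢x
  evalLit-update-other σ b (neg y) y≢x = cong not (update-other σ b y≢x)

  Falsifies : Assignment n → Clause n → Set
  Falsifies σ c = ∀ {l} → l ∈ c → evalLit σ l ≡ false

  agreesFF⇒falsifies : ∀ {c τ} → AgreesFF c τ → Falsifies τ c
  agreesFF⇒falsifies ff {pos x} l∈c = proj₁ (ff x) l∈c
  agreesFF⇒falsifies ff {neg x} l∈c = cong not (proj₂ (ff x) l∈c)

  falsifies⇒agreesFF : ∀ {c τ} → Falsifies τ c → AgreesFF c τ
  falsifies⇒agreesFF f x = f , (λ ¬x∈c → not-injective (f ¬x∈c))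

  evalClause-falsified : ∀ {σ} c → Falsifies σ c → evalClause σ c ≡ false
  evalClause-falsified []      f = refl
  evalClause-falsified (l ∷ c) f rewrite f (here refl) = evalClause-falsified c (λ l∈c → f (there l∈c))

  evalCNF-falsified : ∀ {σ c} (φ : CNF n) → c ∈ φ → evalClause σ c ≡ false → evalCNF σ φ ≡ false
  evalCNF-falsified (d ∷ φ) (here refl) e rewrite e = refl
  evalCNF-falsified (d ∷ φ) (there c∈φ) e rewrite evalCNF-falsified φ c∈φ e = ∧-zeroʳ _

  falsifies-update : ∀ {σ c y} b → qlen c ≤ toℕ y → Falsifies σ c → Falsifies (update σ y b) c
  falsifies-update {σ} {c} b c≤y f {l} l∈c =
    trans (evalLit-update-other σ b l (var≢ c l∈c c≤y)) (f l∈c)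

  agreeBelow-update : ∀ {i σ τ y} b → i ≤ toℕ y → AgreeBelow i σ τ → AgreeBelow i (update σ y b) τ
  agreeBelow-update {σ = σ} b i≤y agree x x<i =
    trans (update-other σ b (λ { refl → <⇒≱ x<i i≤y })) (agree x x<i)

  module _ {c d : Clause n} {ℓ : Lit n} (ℓ∈d : ℓ ∈ d) (d⊆c : ∀ {l} → l ∈ d → l ≢ ℓ → l ∈ c)
           (c≤ℓ : qlen c ≤ toℕ (var ℓ)) where

    qlen-premise : qlen d ≡ suc (toℕ (var ℓ))
    qlen-premise = ≤-antisym (qlen-least d var≤ℓ) (var<qlen d ℓ∈d)
      where
      var≤ℓ : ∀ {l} → l ∈ d → toℕ (var l) < suc (toℕ (var ℓ))
      var≤ℓ {l} l∈d with l ≟ᴸ ℓ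
      ... | yes refl = ≤-refl
      ... | no l≢ℓ   = m≤n⇒m≤1+n (≤-trans (var<qlen c (d⊆c l∈d l≢ℓ)) c≤ℓ)

    falsifies-premise : ∀ {σ} b → evalLit (update σ (var ℓ) b) ℓ ≡ false →
                        Falsifies σ c → Falsifies (update σ (var ℓ) b) d
    falsifies-premise b ℓ-false f {l} l∈d with l ≟ᴸ ℓ
    ... | yes refl = ℓ-false
    ... | no l≢ℓ   = falsifies-update b c≤ℓ f (d⊆c l∈d l≢ℓ)

module _ {n : ℕ} (Q : Prefix n) (φ : CNF n) where

  pr-∷-∃ : ∀ {x xs σ} → Q x ≡ ∃Q →
           pr Q φ (x ∷ xs) σ ≡ pr Q φ xs (update σ x true) ⊔ pr Q φ xs (update σ x false)
  pr-∷-∃ {x} Qx≡∃ with Q x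
  pr-∷-∃ refl | ∃Q = refl

  pr-∷-R : ∀ {x xs σ p h₀ h₁} → Q x ≡ RQ p h₀ h₁ →
           pr Q φ (x ∷ xs) σ ≡ p * pr Q φ xs (update σ x true) + (1ℚ - p) * pr Q φ xs (update σ x false)
  pr-∷-R {x} Qx≡R with Q x
  pr-∷-R refl | RQ _ _ _ = refl

  pr-∷-const : ∀ {x xs σ v} → (∀ b → pr Q φ xs (update σ x b) ≡ v) → pr Q φ (x ∷ xs) σ ≡ v
  pr-∷-const {x} {v = v} h with Q x
  ... | ∃Q       = trans (cong₂ _⊔_ (h true) (h false)) (⊔-idem v)
  ... | RQ p _ _ = trans (cong₂ (λ a b → p * a + (1ℚ - p) * b) (h true) (h false)) (p*v+[1-p]*v≡v p v)

  Stable : (Assignment n → Set) → Fin n → Set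
  Stable P y = ∀ {σ} b → P σ → P (update σ y b)

  pr-invariant : ∀ {P v ys} xs → All (Stable P) xs →
                 (∀ {σ} → P σ → pr Q φ ys σ ≡ v) → ∀ {σ} → P σ → pr Q φ (xs ++ ys) σ ≡ v
  pr-invariant []       []               base Pσ = base Pσ
  pr-invariant (x ∷ xs) (stable ∷ stables) base Pσ =
    pr-∷-const (λ b → pr-invariant xs stables base (stable b Pσ))

  pr-suffix-invariant : ∀ {P v i j} → i ≤ j → (∀ {y} → i ≤ toℕ y → Stable P y) →
                        (∀ {σ} → P σ → pr Q φ (suffixVars n j) σ ≡ v) →
                        ∀ {σ} → P σ → pr Q φ (suffixVars n i) σ ≡ v
  pr-suffix-invariant {v = v} {i} {j} i≤j stable base {σ} Pσ =
    subst (λ xs → pr Q φ xs σ ≡ v) (sym (suffixVars-++ i≤j))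
      (pr-invariant _ (take⁺ (j ∸ i) (All.map stable (suffixVars-≥ i))) base Pσ)

  pr-complete : ∀ {σ b} → evalCNF σ φ ≡ b → pr Q φ (suffixVars n n) σ ≡ (if b then 1ℚ else 0ℚ)
  pr-complete φσ≡b rewrite suffixVars-all {n} | φσ≡b = refl

  pr-premise : ∀ {c d p σ} {ℓ : Lit n} → ℓ ∈ d → (∀ {l} → l ∈ d → l ≢ ℓ → l ∈ c) →
               qlen c ≤ toℕ (var ℓ) → (∀ {τ} → Falsifies τ d → pr Q φ (suffixVars n (qlen d)) τ ≡ p) →
               ∀ b → evalLit (update σ (var ℓ) b) ℓ ≡ false → Falsifies σ c →
               pr Q φ (suffixVars n (suc (toℕ (var ℓ)))) (update σ (var ℓ) b) ≡ p
  pr-premise {p = p} {σ} ℓ∈d d⊆c c≤ℓ value b ℓ-false f =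
    subst (λ k → pr Q φ (suffixVars n k) (update σ _ b) ≡ p) (qlen-premise ℓ∈d d⊆c c≤ℓ)
      (value (falsifies-premise ℓ∈d d⊆c c≤ℓ b ℓ-false f))

  pr-resolvent : ∀ {d₁ d₂ c p₁ p₂} (x : Fin n) (combine : ℚ → ℚ → ℚ) →
    (∀ {σ} → pr Q φ (x ∷ suffixVars n (suc (toℕ x))) σ
               ≡ combine (pr Q φ (suffixVars n (suc (toℕ x))) (update σ x true))
                         (pr Q φ (suffixVars n (suc (toℕ x))) (update σ x false))) →
    neg x ∈ d₁ → pos x ∈ d₂ →
    (∀ l → (l ∈ d₁ × l ≢ neg x) ⊎ (l ∈ d₂ × l ≢ pos x) → l ∈ c) → qlen c ≤ toℕ x →
    (∀ {τ} → Falsifies τ d₁ → pr Q φ (suffixVars n (qlen d₁)) τ ≡ p₁) →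
    (∀ {τ} → Falsifies τ d₂ → pr Q φ (suffixVars n (qlen d₂)) τ ≡ p₂) →
    ∀ {τ} → Falsifies τ c → pr Q φ (suffixVars n (qlen c)) τ ≡ combine p₁ p₂
  pr-resolvent {d₁} {d₂} {c} {p₁} {p₂} x combine unfold ¬x∈d₁ x∈d₂ ⊆c c≤x value₁ value₂ =
    pr-suffix-invariant c≤x (λ c≤y b → falsifies-update b c≤y) at-pivot
    where
    d₁⊆c : ∀ {l} → l ∈ d₁ → l ≢ neg x → l ∈ c
    d₁⊆c l∈d₁ l≢¬x = ⊆c _ (inj₁ (l∈d₁ , l≢¬x))

    d₂⊆c : ∀ {l} → l ∈ d₂ → l ≢ pos x → l ∈ c
    d₂⊆c l∈d₂ l≢x = ⊆c _ (inj₂ (l∈d₂ , l≢x))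

    at-pivot : ∀ {σ} → Falsifies σ c → pr Q φ (suffixVars n (toℕ x)) σ ≡ combine p₁ p₂
    at-pivot {σ} f = begin
      pr Q φ (suffixVars n (toℕ x)) σ                 ≡⟨ cong (λ xs → pr Q φ xs σ) (suffixVars-∷ x) ⟩
      pr Q φ (x ∷ suffixVars n (suc (toℕ x))) σ       ≡⟨ unfold ⟩
      combine (pr Q φ (suffixVars n (suc (toℕ x))) (update σ x true))
              (pr Q φ (suffixVars n (suc (toℕ x))) (update σ x false))
        ≡⟨ cong₂ combine
             (pr-premise ¬x∈d₁ d₁⊆c c≤x value₁ true (cong not (update-same σ x true)) f)
             (pr-premise x∈d₂ d₂⊆c c≤x value₂ false (update-same σ x false) f) ⟩
      combine p₁ p₂                                   ∎
      where open ≡-Reasoning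

  pr-derived : ∀ {c p} → Derives Q φ c p → ∀ {τ} → Falsifies τ c → pr Q φ (suffixVars n (qlen c)) τ ≡ p
  pr-derived {c} (R1 c∈φ) =
    pr-suffix-invariant (qlen≤n c) (λ c≤y b → falsifies-update b c≤y)
      (λ f → pr-complete (evalCNF-falsified φ c∈φ (evalClause-falsified c f)))
  pr-derived {c} (R2 _ _ valid) {τ} f =
    pr-suffix-invariant {P = λ σ → AgreeBelow (qlen c) σ τ} (qlen≤n c)
      (λ c≤y b → agreeBelow-update b c≤y)
      (λ agree → pr-complete (valid τ (falsifies⇒agreesFF f) _ agree)) (λ _ _ → refl)
  pr-derived (R3∃ x D₁ D₂ ¬x∈d₁ x∈d₂ _ ⊆c _ c≤x Qx≡∃) =
    pr-resolvent x _⊔_ (pr-∷-∃ Qx≡∃) ¬x∈d₁ x∈d₂ ⊆c c≤x (pr-derived D₁) (pr-derived D₂)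
  pr-derived (R3R x p _ _ D₁ D₂ ¬x∈d₁ x∈d₂ _ ⊆c _ c≤x Qx≡R) =
    pr-resolvent x (λ a b → p * a + (1ℚ - p) * b) (pr-∷-R Qx≡R)
      ¬x∈d₁ x∈d₂ ⊆c c≤x (pr-derived D₁) (pr-derived D₂)

lemma3p1 : (n : ℕ) (Q : Prefix n) (φ : CNF n) → All ProperClause φ →
           (c : Clause n) (p : ℚ) → Derives Q φ c p →
           (τ : Assignment n) → AgreesFF c τ →
           pr Q φ (suffixVars n (qlen c)) τ ≡ p
lemma3p1 n Q φ _ c p D τ ff = pr-derived Q φ D (agreesFF⇒falsifies ff)
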